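{- Let $B$ be a set, $R$ a binary relation on $B$ and $b_0\in B$. For every $u\in B^*$, $u\in R^*_{\top}(b_0)$ if and only if $u$ belongs to the downward arborification of $R^{\triangleright}_{\top}(b_0)$.
   Context: $B^*$ is the set of finite sequences over $B$; $\langle\rangle$ is the empty sequence, $u\star b$ the extension of $u$ by $b$ at the end, $u'\leq_s u$ means $u'$ is a prefix of $u$. The chaining $R^*_{\top}(b_0)$ of $R$ from $b_0$ is the set of sequences $u=\langle b_1,\dots,b_n\rangle$ ($n\geq 0$) such that $R(b_{i-1},b_i)$ for all $1\leq i\leq n$ (inductively: $\langle\rangle$ is in $R^*_\top(b)$, and $b'$ followed by $u$ is in $R^*_\top(b)$ iff $R(b,b')$ and $u\in R^*_\top(b')$). The alignment $R^{\triangleright}_{\top}(b_0)$ is the predicate on $B^*$ defined by: $\langle\rangle$ belongs to it; a one-element sequence $\langle b\rangle$ belongs to it iff $R(b_0,b)$; a sequence of the form $u'\star b\star b'$ belongs to it iff $R(b,b')$. The downward arborification of a predicate $T$ is $\{u\mid\forall u'\,(u'\leq_s u\Rightarrow u'\in T)\}$. -}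

module Defs where

open import Level using (Level; _⊔_; suc)
open import Data.List using (List; []; _∷_; _++_; [_])
open import Data.Product using (∃)
open import Relation.Binary.PropositionalEquality using (_≡_)

private variable a r : Level

_⋆_ : {B : Set a} → List B → B → List B
u ⋆ b = u ++ [ b ]
infixl 5 _⋆_

_≤s_ : {B : Set a} → List B → List B → Set a
u' ≤s u = ∃ λ v → u' ++ v ≡ u

data Chain {B : Set a} (R : B → B → Set r) : B → List B → Set (a ⊔ r) where
  []  : ∀ {b} → Chain R b []
  _∷_ : ∀ {b b' u} → R b b' → Chain R b' u → Chain R b (b' ∷ u)

data Align {B : Set a} (R : B → B → Set r) (b0 : B) : List B → Set (a ⊔ r) where
  empty : Align R b0 []
  one   : ∀ {b} → R b0 b → Align R b0 [ b ]
  ext   : ∀ {u' b b'} → R b b' → Align R b0 (u' ⋆ b ⋆ b')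

DownArb : {B : Set a} {ℓ : Level} → (List B → Set ℓ) → List B → Set (a ⊔ ℓ)
DownArb T u = ∀ u' → u' ≤s u → T u'

-- A chain from b0 is determined by its consecutive pairs, and the alignment
-- predicate tests exactly the last pair of a sequence (or, for a singleton,
-- the pair (b0, b)).  Testing the alignment on every prefix therefore tests
-- every consecutive pair, i.e. membership in the chaining; conversely chains
-- are prefix-closed and each chain passes the alignment test.
module Submission where

open import Defs
open import Level using (Level)
open import Data.List using (List; []; _∷_; _++_; [_]; _∷ʳ_)
open import Data.List.Properties using (∷ʳ-injective; ∷ʳ-injectiveˡ; ++-assoc; ++-identityʳ)
open import Data.List.Reverse using (Reverse; []; _∶_∶ʳ_; reverseView)
open import Data.Empty using (⊥-elim)
open import Data.Product using (_×_; _,_)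
open import Relation.Binary.PropositionalEquality using (_≡_; _≢_; refl; sym)

private
  variable
    a r ℓ : Level
    B : Set a

∷ʳ≢[] : ∀ (xs : List B) {x} → xs ∷ʳ x ≢ []
∷ʳ≢[] []      ()
∷ʳ≢[] (_ ∷ _) ()

module _ {T : List B → Set ℓ} where

  DownArb⇒∈ : ∀ {u} → DownArb T u → T u
  DownArb⇒∈ {u = u} h = h u ([] , ++-identityʳ u)

  DownArb-∷ʳ⁻ : ∀ {u b} → DownArb T (u ∷ʳ b) → DownArb T u
  DownArb-∷ʳ⁻ {b = b} h u' (v , refl) = h u' (v ∷ʳ b , sym (++-assoc u' v [ b ]))

module _ (R : B → B → Set r) where

  Chain-++⁻ˡ : ∀ {c} u {v} → Chain R c (u ++ v) → Chain R c u
  Chain-++⁻ˡ []      _         = []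
  Chain-++⁻ˡ (_ ∷ u) (rb ∷ ch) = rb ∷ Chain-++⁻ˡ u ch

  Chain-≤s : ∀ {c u u'} → u' ≤s u → Chain R c u → Chain R c u'
  Chain-≤s {u' = u'} (_ , refl) = Chain-++⁻ˡ u'

  Chain-last : ∀ {c} u {b b'} → Chain R c (u ∷ʳ b ∷ʳ b') → R b b'
  Chain-last []      (_ ∷ rbb' ∷ []) = rbb'
  Chain-last (_ ∷ u) (_ ∷ ch)        = Chain-last u ch

  Chain-∷ʳ : ∀ {c} u {b b'} → Chain R c (u ∷ʳ b) → R b b' → Chain R c (u ∷ʳ b ∷ʳ b')
  Chain-∷ʳ []      (rb ∷ []) rbb' = rb ∷ rbb' ∷ []
  Chain-∷ʳ (_ ∷ u) (rx ∷ ch) rbb' = rx ∷ Chain-∷ʳ u ch rbb'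

module _ (R : B → B → Set r) (b0 : B) where

  -- The indices of Align are not constructor patterns, so its inversions take
  -- the shape of the list as an explicit equation.
  Align-head : ∀ {v b} → Align R b0 v → v ≡ [ b ] → R b0 b
  Align-head (one r0)        refl = r0
  Align-head (ext {u'} {x} _) e   =
    ⊥-elim (∷ʳ≢[] u' (∷ʳ-injectiveˡ (u' ∷ʳ x) [] e))

  Align-last : ∀ {v} u {b b'} → Align R b0 v → v ≡ u ∷ʳ b ∷ʳ b' → R b b'
  Align-last u {b} empty   e = ⊥-elim (∷ʳ≢[] (u ∷ʳ b) (sym e))
  Align-last u {b} (one _) e = ⊥-elim (∷ʳ≢[] u (sym (∷ʳ-injectiveˡ [] (u ∷ʳ b) e)))
  Align-last u {b} (ext {u'} {x} rxy) e with ∷ʳ-injective (u' ∷ʳ x) (u ∷ʳ b) e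
  ... | e₁ , refl with ∷ʳ-injective u' u e₁
  ... | _ , refl = rxy

  Chain⇒Align : ∀ {u} → Reverse u → Chain R b0 u → Align R b0 u
  Chain⇒Align []                          _         = empty
  Chain⇒Align (_ ∶ [] ∶ʳ _)               (rb ∷ []) = one rb
  Chain⇒Align (_ ∶ (u ∶ _ ∶ʳ _) ∶ʳ _)     ch        = ext (Chain-last R u ch)

  DownArb⇒Chain : ∀ {u} → Reverse u → DownArb (Align R b0) u → Chain R b0 u
  DownArb⇒Chain []                _ = []
  DownArb⇒Chain (_ ∶ [] ∶ʳ _)     h = Align-head (DownArb⇒∈ h) refl ∷ []
  DownArb⇒Chain (_ ∶ (u ∶ ru ∶ʳ b) ∶ʳ _) h =
    Chain-∷ʳ R u (DownArb⇒Chain (u ∶ ru ∶ʳ b) (DownArb-∷ʳ⁻ h))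
                 (Align-last u (DownArb⇒∈ h) refl)

proposition8 : ∀ {a r : Level} {B : Set a} (R : B → B → Set r) (b0 : B) (u : List B) →
    (Chain R b0 u → DownArb (Align R b0) u) × (DownArb (Align R b0) u → Chain R b0 u)
proposition8 R b0 u =
    (λ ch u' u'≤u → Chain⇒Align R b0 (reverseView u') (Chain-≤s R u'≤u ch))
  , DownArb⇒Chain R b0 (reverseView u)
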